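{- Let $k\geq 1$ and let $M$ be a set of $n\geq 2$ positive integers. There is a bijection $\chi:\widetilde{\mathcal{Q}}_M(k)\to\mathcal{T}_M(k)$ such that $\mathrm{ap}(\pi)=\mathrm{lleaf}(\chi(\pi))$ for every $\pi\in\widetilde{\mathcal{Q}}_M(k)$. Moreover, for every $\pi=\pi_1\pi_2\cdots\in\widetilde{\mathcal{Q}}_M(k)$, one has $\pi_1=\pi_2=\cdots=\pi_k$ if and only if the first $k-1$ children (from the left) of the root of $\chi(\pi)$ are leaves.
   Context: For $M=\{a_1<\dots<a_n\}$, $M_k$ denotes the multiset $\{a_1^k,\dots,a_n^k\}$. A Stirling permutation of a multiset is a word $\pi=\pi_1\pi_2\cdots$ using exactly the multiset's elements such that $\pi_i=\pi_l$ with $i<l$ implies $\pi_j\geq\pi_i$ for all $i<j<l$. $\widetilde{\mathcal{Q}}_M(k)$ is the set of Stirling permutations of $M_k$ whose first letter is $\min M$. For $\pi=\pi_1\cdots\pi_{kn}$, an index $i$ is a longest ascent-plateau if $\pi_i<\pi_{i+1}=\cdots=\pi_{i+k}$; $\mathrm{ap}(\pi)$ is the number of longest ascent-plateaux of $\pi$. Trees: all trees are ordered (plane) rooted trees; the level of a node is its distance from the root (root at level 0); a leaf is a node with no children. An even $k$-ary tree is an ordered tree in which every node on an even level has exactly $k$ children. A pruned even $k$-ary tree is obtained from an even $k$-ary tree by deleting, for every even-level node all of whose children are leaves, all those children. An increasing pruned even $k$-ary tree on $M$ is a pruned even $k$-ary tree whose nodes on even levels are labeled bijectively by $M$ (odd-level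 nodes are unlabeled) such that labels increase along every path from the root downward and, for each node, the labels of its children increase from left to right. $\mathcal{T}_M(k)$ is the set of such trees. A labeled leaf is a leaf on an even level; $\mathrm{lleaf}(T)$ is the number of labeled leaves of $T$. -}

module Defs where

open import Data.Nat using (ℕ; zero; suc; _+_; _∸_; _≤_; _<_; _<ᵇ_; _≤ᵇ_; _≡ᵇ_)
open import Data.Bool using (Bool; true; false; _∧_; if_then_else_)
open import Data.List using (List; []; _∷_; length; take; concatMap; replicate; lookup; map; _++_)
open import Data.List.Relation.Unary.All using (All)
open import Data.List.Relation.Unary.Linked using (Linked)
open import Data.List.Relation.Binary.Permutation.Propositional using (_↭_)
open import Data.Fin using (Fin; toℕ)
open import Data.Product using (_×_; Σ; ∃)
open import Data.Unit using (⊤)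
open import Data.Maybe using (Maybe; just; nothing)
open import Relation.Binary.PropositionalEquality using (_≡_)

-- The multiset M_k, as the word a₁^k a₂^k ⋯ aₙ^k (used only up to ↭).
multisetK : ℕ → List ℕ → List ℕ
multisetK k M = concatMap (replicate k) M

IsStirling : List ℕ → Set
IsStirling π = (i j l : Fin (length π)) → toℕ i < toℕ j → toℕ j < toℕ l →
               lookup π i ≡ lookup π l → lookup π i ≤ lookup π j

headM : List ℕ → Maybe ℕ
headM [] = nothing
headM (x ∷ _) = just x

-- π ∈ Q̃_M(k): a Stirling permutation of M_k whose first letter is min M
-- (M is given by its increasing listing, so min M is its head).
InQ : List ℕ → ℕ → List ℕ → Set
InQ M k π = (π ↭ multisetK k M) × IsStirling π × (headM π ≡ headM M)

allEq : ℕ → List ℕ → Bool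
allEq y [] = true
allEq y (z ∷ zs) = (z ≡ᵇ y) ∧ allEq y zs

isAPStart : ℕ → List ℕ → Bool
isAPStart k (x ∷ y ∷ ys) =
  (x <ᵇ y) ∧ ((k ≤ᵇ length (y ∷ ys)) ∧ allEq y (take k (y ∷ ys)))
isAPStart k _ = false

ap : ℕ → List ℕ → ℕ
ap k [] = 0
ap k (x ∷ xs) = (if isAPStart k (x ∷ xs) then 1 else 0) + ap k xs

FirstKEqual : ℕ → List ℕ → Set
FirstKEqual k [] = ⊤
FirstKEqual k (x ∷ xs) = All (x ≡_) (take k (x ∷ xs))

-- Trees: ordered rooted trees whose even-level nodes carry a label (ℕ)
-- and whose odd-level nodes are unlabeled.

data ENode : Set
data ONode : Set

data ENode where
  enode : ℕ → List ONode → ENode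

data ONode where
  onode : List ENode → ONode

mutual
  EvenKaryE : ℕ → ENode → Set
  EvenKaryE k (enode a cs) = (length cs ≡ k) × EvenKaryOs k cs

  EvenKaryOs : ℕ → List ONode → Set
  EvenKaryOs k [] = ⊤
  EvenKaryOs k (c ∷ cs) = EvenKaryO k c × EvenKaryOs k cs

  EvenKaryO : ℕ → ONode → Set
  EvenKaryO k (onode es) = EvenKaryEs k es

  EvenKaryEs : ℕ → List ENode → Set
  EvenKaryEs k [] = ⊤
  EvenKaryEs k (e ∷ es) = EvenKaryE k e × EvenKaryEs k es

allLeaves : List ONode → Bool
allLeaves [] = true
allLeaves (onode [] ∷ cs) = allLeaves cs
allLeaves (onode (_ ∷ _) ∷ cs) = false

mutual
  pruneE : ENode → ENode
  pruneE (enode a cs) = if allLeaves cs then enode a [] else enode a (pruneOs cs)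

  pruneOs : List ONode → List ONode
  pruneOs [] = []
  pruneOs (c ∷ cs) = pruneO c ∷ pruneOs cs

  pruneO : ONode → ONode
  pruneO (onode es) = onode (pruneEs es)

  pruneEs : List ENode → List ENode
  pruneEs [] = []
  pruneEs (e ∷ es) = pruneE e ∷ pruneEs es

IsPrunedEvenKary : ℕ → ENode → Set
IsPrunedEvenKary k T = Σ ENode (λ E → EvenKaryE k E × (pruneE E ≡ T))

mutual
  labelsE : ENode → List ℕ
  labelsE (enode a cs) = a ∷ labelsOs cs

  labelsOs : List ONode → List ℕ
  labelsOs [] = []
  labelsOs (c ∷ cs) = labelsO c ++ labelsOs cs

  labelsO : ONode → List ℕ
  labelsO (onode es) = labelsEs es

  labelsEs : List ENode → List ℕ
  labelsEs [] = []
  labelsEs (e ∷ es) = labelsE e ++ labelsEs es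

rootLabel : ENode → ℕ
rootLabel (enode a _) = a

mutual
  IncreasingE : ENode → Set
  IncreasingE (enode a cs) = All (a <_) (labelsOs cs) × IncreasingOs cs

  IncreasingOs : List ONode → Set
  IncreasingOs [] = ⊤
  IncreasingOs (c ∷ cs) = IncreasingO c × IncreasingOs cs

  IncreasingO : ONode → Set
  IncreasingO (onode es) = Linked _<_ (map rootLabel es) × IncreasingEs es

  IncreasingEs : List ENode → Set
  IncreasingEs [] = ⊤
  IncreasingEs (e ∷ es) = IncreasingE e × IncreasingEs es

InT : List ℕ → ℕ → ENode → Set
InT M k T = IsPrunedEvenKary k T × (labelsE T ↭ M) × IncreasingE T

mutual
  lleafE : ENode → ℕ
  lleafE (enode a []) = 1
  lleafE (enode a (c ∷ cs)) = lleafOs (c ∷ cs)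

  lleafOs : List ONode → ℕ
  lleafOs [] = 0
  lleafOs (c ∷ cs) = lleafO c + lleafOs cs

  lleafO : ONode → ℕ
  lleafO (onode es) = lleafEs es

  lleafEs : List ENode → ℕ
  lleafEs [] = 0
  lleafEs (e ∷ es) = lleafE e + lleafEs es

IsLeafO : ONode → Set
IsLeafO (onode es) = es ≡ []

FirstRootChildrenLeaves : ℕ → ENode → Set
FirstRootChildrenLeaves k (enode a cs) = All IsLeafO (take (k ∸ 1) cs)

-- χ is the inverse of a word map on trees.  A labelled node c with children o₁ … o_k is written
-- w(o₁) c w(o₂) c ⋯ w(o_k) c (a leaf c as c^k) and a forest as the concatenation of its words;
-- χ⁻¹(T) is the word of T with its last letter, the root label, moved to the front.  Since labels
-- increase downwards and siblings' subtrees carry disjoint labels, this is a Stirling permutation of M_k.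
-- Conversely, in a Stirling word in which every letter occurs 0 or k times, the k copies of the least
-- letter m cut it into k gaps and a remainder, and no letter occurs on both sides of a copy of m; so the
-- word is decoded recursively, and the decoding is unique because the least letter of a forest word is
-- its first root.  Longest ascent-plateaux p c^k are produced exactly by the labelled leaves c, and
-- π₁ = ⋯ = π_k says that the first k − 1 gaps at the root are empty, i.e. those children are leaves.
module Submission where

open import Defs
open import Data.Nat using (ℕ; zero; suc; _+_; _*_; _≤_; _<_; z≤n; s≤s; _≟_; _<ᵇ_; _≤ᵇ_; _≡ᵇ_)
open import Data.Nat.Properties
open import Data.Nat.Solver using (module +-*-Solver)
open +-*-Solver using (solve; _:+_; _:*_; con; _:=_)
open import Data.Bool using (true; false; _∧_; if_then_else_; T)
open import Data.Bool.Properties using (∧-zeroʳ; T-∧)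
open import Data.Fin using (Fin; toℕ) renaming (zero to fzero; suc to fsuc)
open import Data.List using (List; []; _∷_; _++_; [_]; length; replicate; map; filter; take; lookup)
open import Data.List.Properties
  using (++-assoc; ++-identityʳ; length-++; length-map; length-replicate; filter-++; filter-accept; filter-reject; filter-none;
         ∷-injective; ∷-injectiveˡ; ∷-injectiveʳ; ∷ʳ-injectiveˡ)
open import Data.List.Membership.Propositional using (_∈_; _∉_)
open import Data.List.Membership.Propositional.Properties using (∈-filter⁺; ∈-filter⁻; ∈-∃++; ∈-++⁻; ∈-++⁺ˡ; ∈-++⁺ʳ; ∈-lookup)
open import Data.List.Membership.DecPropositional _≟_ using (_∈?_)
open import Data.List.Relation.Unary.Any using (here; there)
open import Data.List.Relation.Unary.All as All using (All; []; _∷_)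
import Data.List.Relation.Unary.All.Properties as All
open import Data.List.Relation.Unary.AllPairs using (AllPairs; []; _∷_)
open import Data.List.Relation.Unary.Linked as Linked using (Linked; []; [-]; _∷_)
open import Data.List.Relation.Binary.Permutation.Propositional using (_↭_; ↭-refl; ↭-sym; ↭-trans; ↭-prep)
open import Data.List.Relation.Binary.Permutation.Propositional.Properties using (↭-length; filter-↭; shift; ∈-resp-↭)
open import Data.Product using (Σ; Σ-syntax; ∃; ∃₂; _×_; _,_; proj₁; proj₂)
open import Data.Sum as Sum using (_⊎_; inj₁; inj₂)
open import Data.Unit using (⊤; tt)
open import Data.Maybe using (just)
open import Data.Empty using (⊥-elim)
open import Function using (_∘_)
open import Function.Bundles using (Equivalence; _⇔_; mk⇔)
open import Relation.Nullary using (yes; no)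
open import Relation.Binary.PropositionalEquality using (_≡_; _≢_; refl; sym; trans; cong; cong₂; subst; module ≡-Reasoning)

opaque
  count : ℕ → List ℕ → ℕ
  count v xs = length (filter (v ≟_) xs)

  count-[] : ∀ v → count v [] ≡ 0
  count-[] v = refl

  count-++ : ∀ v xs ys → count v (xs ++ ys) ≡ count v xs + count v ys
  count-++ v xs ys = trans (cong length (filter-++ (v ≟_) xs ys)) (length-++ (filter (v ≟_) xs))

  count-↭ : ∀ v {xs ys} → xs ↭ ys → count v xs ≡ count v ys
  count-↭ v p = ↭-length (filter-↭ (v ≟_) p)

  count-here : ∀ v xs → count v (v ∷ xs) ≡ suc (count v xs)
  count-here v xs = cong length (filter-accept (v ≟_) refl)

  count-there : ∀ {v x} xs → v ≢ x → count v (x ∷ xs) ≡ count v xs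
  count-there xs v≢x = cong length (filter-reject (_ ≟_) v≢x)

  ∉⇒count≡0 : ∀ {v xs} → v ∉ xs → count v xs ≡ 0
  ∉⇒count≡0 {v} {xs} v∉xs = cong length (filter-none (v ≟_) (All.¬Any⇒All¬ xs v∉xs))

  ∈⇒count>0 : ∀ {v xs} → v ∈ xs → 0 < count v xs
  ∈⇒count>0 {v} {xs} v∈xs with filter (v ≟_) xs | ∈-filter⁺ (v ≟_) v∈xs refl
  ... | _ ∷ _ | _ = s≤s z≤n

  count>0⇒∈ : ∀ {v xs} → 0 < count v xs → v ∈ xs
  count>0⇒∈ {v} {xs} pos with filter (v ≟_) xs in eq
  ... | y ∷ _ with ∈-filter⁻ (v ≟_) (subst (y ∈_) (sym eq) (here refl))
  ...   | y∈xs , refl = y∈xs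

count-∷ : ∀ v x xs → count v (x ∷ xs) ≡ count v [ x ] + count v xs
count-∷ v x xs = count-++ v [ x ] xs

count≡0⇒∉ : ∀ {v xs} → count v xs ≡ 0 → v ∉ xs
count≡0⇒∉ eq v∈xs = <-irrefl (sym eq) (∈⇒count>0 v∈xs)

count-replicate : ∀ v n x → count v (replicate n x) ≡ n * count v [ x ]
count-replicate v zero x = count-[] v
count-replicate v (suc n) x = trans (count-++ v [ x ] (replicate n x)) (cong (count v [ x ] +_) (count-replicate v n x))

count-multisetK : ∀ v k M → count v (multisetK k M) ≡ k * count v M
count-multisetK v k [] = trans (count-[] v) (sym (trans (cong (k *_) (count-[] v)) (*-zeroʳ k)))
count-multisetK v k (x ∷ M) = begin
  count v (replicate k x ++ multisetK k M)           ≡⟨ count-++ v (replicate k x) _ ⟩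
  count v (replicate k x) + count v (multisetK k M)  ≡⟨ cong₂ _+_ (count-replicate v k x) (count-multisetK v k M) ⟩
  k * count v [ x ] + k * count v M                  ≡⟨ *-distribˡ-+ k (count v [ x ]) _ ⟨
  k * (count v [ x ] + count v M)                    ≡⟨ cong (k *_) (count-∷ v x M) ⟨
  k * count v (x ∷ M)                                ∎
  where open ≡-Reasoning

count-∷ʳ : ∀ v x xs → count v (xs ++ [ x ]) ≡ count v (x ∷ xs)
count-∷ʳ v x xs = begin
  count v (xs ++ [ x ])         ≡⟨ count-++ v xs [ x ] ⟩
  count v xs + count v [ x ]    ≡⟨ +-comm (count v xs) _ ⟩
  count v [ x ] + count v xs    ≡⟨ count-∷ v x xs ⟨
  count v (x ∷ xs)              ∎
  where open ≡-Reasoning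

count-first : ∀ m as bs → m ∉ as → count m (as ++ m ∷ bs) ≡ suc (count m bs)
count-first m as bs m∉as = begin
  count m (as ++ m ∷ bs)          ≡⟨ count-++ m as (m ∷ bs) ⟩
  count m as + count m (m ∷ bs)   ≡⟨ cong (_+ count m (m ∷ bs)) (∉⇒count≡0 m∉as) ⟩
  count m (m ∷ bs)                ≡⟨ count-here m bs ⟩
  suc (count m bs)                ∎
  where open ≡-Reasoning

counts⇒↭ : ∀ xs ys → (∀ v → count v xs ≡ count v ys) → xs ↭ ys
counts⇒↭ [] [] _ = ↭-refl
counts⇒↭ [] (y ∷ ys) same = ⊥-elim (0≢1+n (trans (sym (count-[] y)) (trans (same y) (count-here y ys))))
counts⇒↭ (x ∷ xs) ys same
  with as , bs , refl ← ∈-∃++ (count>0⇒∈ {x} {ys} (subst (0 <_) (same x) (∈⇒count>0 {x} {x ∷ xs} (here refl))))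
  = ↭-trans (↭-prep x (counts⇒↭ xs (as ++ bs) same′)) (↭-sym (shift x as bs))
  where
  same′ : ∀ v → count v xs ≡ count v (as ++ bs)
  same′ v = +-cancelˡ-≡ (count v [ x ]) _ _ (begin
    count v [ x ] + count v xs          ≡⟨ count-++ v [ x ] xs ⟨
    count v (x ∷ xs)                    ≡⟨ same v ⟩
    count v (as ++ x ∷ bs)              ≡⟨ count-↭ v (shift x as bs) ⟩
    count v ([ x ] ++ as ++ bs)         ≡⟨ count-++ v [ x ] (as ++ bs) ⟩
    count v [ x ] + count v (as ++ bs)  ∎)
    where open ≡-Reasoning

Distinct : List ℕ → Set
Distinct xs = ∀ v → count v xs ≤ 1

Distinct-++ˡ : ∀ xs {ys} → Distinct (xs ++ ys) → Distinct xs
Distinct-++ˡ xs {ys} d v = ≤-trans (m≤m+n _ _) (subst (_≤ 1) (count-++ v xs ys) (d v))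

Distinct-++ʳ : ∀ xs {ys} → Distinct (xs ++ ys) → Distinct ys
Distinct-++ʳ xs {ys} d v = ≤-trans (m≤n+m _ _) (subst (_≤ 1) (count-++ v xs ys) (d v))

Distinct-++⇒disjoint : ∀ xs {ys v} → Distinct (xs ++ ys) → v ∈ xs → v ∉ ys
Distinct-++⇒disjoint xs {ys} {v} d v∈xs v∈ys =
  <-irrefl refl (≤-trans (+-mono-≤ (∈⇒count>0 v∈xs) (∈⇒count>0 v∈ys)) (subst (_≤ 1) (count-++ v xs ys) (d v)))

sorted⇒Distinct : ∀ {xs} → AllPairs _<_ xs → Distinct xs
sorted⇒Distinct [] v = subst (_≤ 1) (sym (count-[] v)) z≤n
sorted⇒Distinct {x ∷ xs} (x<xs ∷ sorted) v with v ≟ x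
... | yes refl = ≤-reflexive (trans (count-here v xs) (cong suc (∉⇒count≡0 (λ v∈xs → <-irrefl refl (All.lookup x<xs v∈xs)))))
... | no v≢x = subst (_≤ 1) (sym (count-there xs v≢x)) (sorted⇒Distinct sorted v)

∈-replicate⁻ : ∀ {v c : ℕ} n → v ∈ replicate n c → v ≡ c
∈-replicate⁻ (suc n) (here eq) = eq
∈-replicate⁻ (suc n) (there p) = ∈-replicate⁻ n p

∈-multisetK⁻ : ∀ {v} k M → v ∈ multisetK k M → v ∈ M
∈-multisetK⁻ k (x ∷ M) v∈ with ∈-++⁻ (replicate k x) v∈
... | inj₁ v∈x = here (∈-replicate⁻ k v∈x)
... | inj₂ v∈M = there (∈-multisetK⁻ k M v∈M)

head-≤ : ∀ {m₀ M v} → AllPairs _<_ (m₀ ∷ M) → v ∈ m₀ ∷ M → m₀ ≤ v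
head-≤ _ (here refl) = ≤-refl
head-≤ (m₀<M ∷ _) (there v∈M) = <⇒≤ (All.lookup m₀<M v∈M)

≤∧∉⇒< : ∀ {m} xs → All (m ≤_) xs → m ∉ xs → All (m <_) xs
≤∧∉⇒< xs m≤ m∉ = All.tabulate λ v∈ → ≤∧≢⇒< (All.lookup m≤ v∈) (λ { refl → m∉ v∈ })

least : ∀ (x : ℕ) xs → ∃ λ m → m ∈ x ∷ xs × All (m ≤_) (x ∷ xs)
least x [] = x , here refl , ≤-refl ∷ []
least x (y ∷ ys) with m , m∈ , m≤ ← least y ys with x ≤? m
... | yes x≤m = x , here refl , ≤-refl ∷ All.map (≤-trans x≤m) m≤
... | no x≰m = m , there m∈ , <⇒≤ (≰⇒> x≰m) ∷ m≤

first-split : ∀ (m : ℕ) xs → m ∈ xs → ∃₂ λ as bs → xs ≡ as ++ m ∷ bs × m ∉ as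
first-split m (x ∷ xs) m∈ with m ≟ x
... | yes refl = [] , xs , refl , λ ()
first-split m (x ∷ xs) (here m≡x) | no m≢x = ⊥-elim (m≢x m≡x)
first-split m (x ∷ xs) (there m∈) | no m≢x with as , bs , refl , m∉as ← first-split m xs m∈ =
  x ∷ as , bs , refl , λ { (here m≡x) → m≢x m≡x ; (there m∈as) → m∉as m∈as }

-- Stirling words

Guard : ℕ → List ℕ → Set
Guard x [] = ⊤
Guard x (y ∷ ys) = (x ∈ ys → x ≤ y) × Guard x ys

Stirling : List ℕ → Set
Stirling [] = ⊤
Stirling (x ∷ xs) = Guard x xs × Stirling xs

position : ∀ {x : ℕ} xs → x ∈ xs → Σ (Fin (length xs)) λ i → lookup xs i ≡ x
position (y ∷ ys) (here refl) = fzero , refl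
position (y ∷ ys) (there p) with i , eq ← position ys p = fsuc i , eq

IsStirling⇒Stirling : ∀ xs → IsStirling xs → Stirling xs
IsStirling⇒Stirling [] _ = tt
IsStirling⇒Stirling (x ∷ xs) st = guard xs (λ j l j<l eq → st fzero (fsuc j) (fsuc l) (s≤s z≤n) (s≤s j<l) (sym eq))
                              , IsStirling⇒Stirling xs (λ i j l i<j j<l → st (fsuc i) (fsuc j) (fsuc l) (s≤s i<j) (s≤s j<l))
  where
  guard : ∀ ys → (∀ (j l : Fin (length ys)) → toℕ j < toℕ l → lookup ys l ≡ x → x ≤ lookup ys j) → Guard x ys
  guard [] _ = tt
  guard (y ∷ ys) between = (λ x∈ys → let l , eq = position ys x∈ys in between fzero (fsuc l) (s≤s z≤n) eq)
                         , guard ys (λ j l j<l → between (fsuc j) (fsuc l) (s≤s j<l))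

Stirling⇒IsStirling : ∀ xs → Stirling xs → IsStirling xs
Stirling⇒IsStirling (x ∷ xs) (g , _) fzero (fsuc j) (fsuc l) _ (s≤s j<l) eq = guarded xs g j l j<l (sym eq)
  where
  guarded : ∀ ys → Guard x ys → ∀ (j l : Fin (length ys)) → toℕ j < toℕ l → lookup ys l ≡ x → x ≤ lookup ys j
  guarded (y ∷ ys) (g , _) fzero (fsuc l) _ eq = g (subst (_∈ ys) eq (∈-lookup l))
  guarded (y ∷ ys) (_ , g) (fsuc j) (fsuc l) (s≤s j<l) eq = guarded ys g j l j<l eq
Stirling⇒IsStirling (x ∷ xs) (_ , s) (fsuc i) (fsuc j) (fsuc l) (s≤s i<j) (s≤s j<l) eq =
  Stirling⇒IsStirling xs s i j l i<j j<l eq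

Guard-∉ : ∀ {x} ys → x ∉ ys → Guard x ys
Guard-∉ [] _ = tt
Guard-∉ (y ∷ ys) x∉ = (λ x∈ys → ⊥-elim (x∉ (there x∈ys))) , Guard-∉ ys (x∉ ∘ there)

Guard-≤ : ∀ {x} ys → All (x ≤_) ys → Guard x ys
Guard-≤ [] _ = tt
Guard-≤ (y ∷ ys) (x≤y ∷ x≤ys) = (λ _ → x≤y) , Guard-≤ ys x≤ys

Guard-++ : ∀ {x} ys zs → Guard x ys → Guard x zs → x ∉ zs → Guard x (ys ++ zs)
Guard-++ [] zs _ g x∉zs = g
Guard-++ {x} (y ∷ ys) zs (g , gs) g′ x∉zs = guard , Guard-++ ys zs gs g′ x∉zs
  where
  guard : x ∈ ys ++ zs → x ≤ y
  guard x∈ with ∈-++⁻ ys x∈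
  ... | inj₁ x∈ys = g x∈ys
  ... | inj₂ x∈zs = ⊥-elim (x∉zs x∈zs)

Guard-++⁻ˡ : ∀ {x} ys zs → Guard x (ys ++ zs) → Guard x ys
Guard-++⁻ˡ [] zs _ = tt
Guard-++⁻ˡ (y ∷ ys) zs (g , gs) = (g ∘ ∈-++⁺ˡ) , Guard-++⁻ˡ ys zs gs

Guard-++⁻ʳ : ∀ {x} ys zs → Guard x (ys ++ zs) → Guard x zs
Guard-++⁻ʳ [] zs g = g
Guard-++⁻ʳ (y ∷ ys) zs (_ , g) = Guard-++⁻ʳ ys zs g

Guard-∷ʳ : ∀ {x c} ys → All (c ≤_) ys → Guard x ys → Guard x (ys ++ [ c ])
Guard-∷ʳ [] _ _ = (λ ()) , tt
Guard-∷ʳ {x} {c} (y ∷ ys) (c≤y ∷ c≤ys) (g , gs) = guard , Guard-∷ʳ ys c≤ys gs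
  where
  guard : x ∈ ys ++ [ c ] → x ≤ y
  guard x∈ with ∈-++⁻ ys x∈
  ... | inj₁ x∈ys = g x∈ys
  ... | inj₂ (here refl) = c≤y

Stirling-∷ : ∀ {x} xs → All (x ≤_) xs → Stirling xs → Stirling (x ∷ xs)
Stirling-∷ xs x≤xs s = Guard-≤ xs x≤xs , s

Stirling-++ : ∀ xs ys → Stirling xs → Stirling ys → (∀ {v} → v ∈ xs → v ∉ ys) → Stirling (xs ++ ys)
Stirling-++ [] ys _ s _ = s
Stirling-++ (x ∷ xs) ys (g , s) s′ disjoint =
  Guard-++ xs ys g (Guard-∉ ys x∉ys) x∉ys , Stirling-++ xs ys s s′ (disjoint ∘ there)
  where x∉ys = disjoint (here refl)

Stirling-++⁻ˡ : ∀ xs ys → Stirling (xs ++ ys) → Stirling xs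
Stirling-++⁻ˡ [] ys _ = tt
Stirling-++⁻ˡ (x ∷ xs) ys (g , s) = Guard-++⁻ˡ xs ys g , Stirling-++⁻ˡ xs ys s

Stirling-++⁻ʳ : ∀ xs ys → Stirling (xs ++ ys) → Stirling ys
Stirling-++⁻ʳ [] ys s = s
Stirling-++⁻ʳ (x ∷ xs) ys (_ , s) = Stirling-++⁻ʳ xs ys s

Stirling-∷ʳ : ∀ {c} xs → All (c ≤_) xs → Stirling xs → Stirling (xs ++ [ c ])
Stirling-∷ʳ [] _ _ = tt , tt
Stirling-∷ʳ (x ∷ xs) (_ ∷ c≤xs) (g , s) = Guard-∷ʳ xs c≤xs g , Stirling-∷ʳ xs c≤xs s

Stirling-replicate : ∀ n c → Stirling (replicate n c)
Stirling-replicate zero c = tt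
Stirling-replicate (suc n) c = Stirling-∷ (replicate n c) (All.replicate⁺ n ≤-refl) (Stirling-replicate n c)

-- In a Stirling word whose least letter is m, no letter occurs on both sides of an m:
-- the m between two copies of v would force v ≤ m ≤ v.
gap-disjoint : ∀ {m v} g σ → Stirling (g ++ m ∷ σ) → All (m ≤_) (g ++ m ∷ σ) → m ∉ g → v ∈ g → v ∉ σ
gap-disjoint {m} {v} g σ st m≤ m∉g v∈g v∈σ with as , bs , refl ← ∈-∃++ v∈g = m∉g (subst (_∈ as ++ v ∷ bs) v≡m v∈g)
  where
  guard : Guard v (bs ++ m ∷ σ)
  guard = proj₁ (Stirling-++⁻ʳ as (v ∷ bs ++ m ∷ σ) (subst Stirling (++-assoc as (v ∷ bs) (m ∷ σ)) st))
  v≡m : v ≡ m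
  v≡m = ≤-antisym (proj₁ (Guard-++⁻ʳ bs (m ∷ σ) guard) v∈σ) (All.lookup m≤ (∈-++⁺ˡ v∈g))

-- Longest ascent-plateaux

≤⇒<ᵇ≡false : ∀ {m n} → n ≤ m → (m <ᵇ n) ≡ false
≤⇒<ᵇ≡false {m} {n} n≤m with m <ᵇ n in eq
... | false = refl
... | true = ⊥-elim (<⇒≱ (<ᵇ⇒< m n (subst T (sym eq) tt)) n≤m)

≢⇒≡ᵇ≡false : ∀ {m n} → m ≢ n → (m ≡ᵇ n) ≡ false
≢⇒≡ᵇ≡false {m} {n} m≢n with m ≡ᵇ n in eq
... | false = refl
... | true = ⊥-elim (m≢n (≡ᵇ⇒≡ m n (subst T (sym eq) tt)))

T⇒≡true : ∀ {b} → T b → b ≡ true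
T⇒≡true {true} _ = refl

<ᵇ-suc : ∀ m n → (m <ᵇ suc n) ≡ (m ≤ᵇ n)
<ᵇ-suc zero n = refl
<ᵇ-suc (suc m) n = refl

ap-∷-≥ : ∀ k {q c} X → c ≤ q → ap k (q ∷ c ∷ X) ≡ ap k (c ∷ X)
ap-∷-≥ k X c≤q rewrite ≤⇒<ᵇ≡false c≤q = refl

ap-plateau : ∀ k c n r → ap k (c ∷ replicate n c ++ r) ≡ ap k (c ∷ r)
ap-plateau k c zero r = refl
ap-plateau k c (suc n) r = trans (ap-∷-≥ k (replicate n c ++ r) ≤-refl) (ap-plateau k c n r)

allEq-take-replicate : ∀ c n r → T (allEq c (take n (replicate n c ++ r)))
allEq-take-replicate c zero r = tt
allEq-take-replicate c (suc n) r = Equivalence.from T-∧ (≡⇒≡ᵇ c c refl , allEq-take-replicate c n r)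

isAPStart-plateau : ∀ k {p c} r → p < c → isAPStart (suc k) (p ∷ replicate (suc k) c ++ r) ≡ true
isAPStart-plateau k {p} {c} r p<c = T⇒≡true (Equivalence.from T-∧ (<⇒<ᵇ p<c , Equivalence.from T-∧ (≤⇒≤ᵇ long , allEq-take-replicate c (suc k) r)))
  where
  long : suc k ≤ length (replicate (suc k) c ++ r)
  long = subst (suc k ≤_) (sym (length-++ (replicate (suc k) c))) (≤-trans (≤-reflexive (sym (length-replicate (suc k)))) (m≤m+n _ (length r)))

ap-plateau-start : ∀ k {p c} r → p < c → ap (suc k) (p ∷ replicate (suc k) c ++ r) ≡ suc (ap (suc k) (c ∷ r))
ap-plateau-start k {c = c} r p<c rewrite isAPStart-plateau k r p<c = cong suc (ap-plateau (suc k) c k r)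

-- Appending a letter c ≠ y can only spoil a run of y's, never complete one.
plateau-∷ʳ : ∀ k {c y} zs → c ≢ y →
             ((k ≤ᵇ length (zs ++ [ c ])) ∧ allEq y (take k (zs ++ [ c ]))) ≡ ((k ≤ᵇ length zs) ∧ allEq y (take k zs))
plateau-∷ʳ zero zs c≢y = refl
plateau-∷ʳ (suc k) [] c≢y rewrite ≢⇒≡ᵇ≡false c≢y = ∧-zeroʳ _
plateau-∷ʳ (suc k) {c} {y} (z ∷ zs) c≢y with z ≡ᵇ y
... | true = trans (cong (_∧ allEq y (take k (zs ++ [ c ]))) (<ᵇ-suc k (length (zs ++ [ c ]))))
                   (trans (plateau-∷ʳ k zs c≢y) (cong (_∧ allEq y (take k zs)) (sym (<ᵇ-suc k (length zs)))))
... | false = trans (∧-zeroʳ _) (sym (∧-zeroʳ _))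

isAPStart-∷ʳ : ∀ k {c x} ys → c ≤ x → isAPStart k (x ∷ ys ++ [ c ]) ≡ isAPStart k (x ∷ ys)
isAPStart-∷ʳ k [] c≤x rewrite ≤⇒<ᵇ≡false c≤x = refl
isAPStart-∷ʳ k {c} {x} (y ∷ ys) c≤x with x <ᵇ y in x<ᵇy
... | false = refl
... | true = plateau-∷ʳ k (y ∷ ys) (λ { refl → <⇒≱ (<ᵇ⇒< x y (subst T (sym x<ᵇy) tt)) c≤x })

ap-∷ʳ-≤ : ∀ k {c} xs → All (c ≤_) xs → ap k (xs ++ [ c ]) ≡ ap k xs
ap-∷ʳ-≤ k [] _ = refl
ap-∷ʳ-≤ k (x ∷ xs) (c≤x ∷ c≤xs) =
  cong₂ _+_ (cong (λ b → if b then 1 else 0) (isAPStart-∷ʳ k xs c≤x)) (ap-∷ʳ-≤ k xs c≤xs)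

joinWith : ℕ → List (List ℕ) → List ℕ → List ℕ
joinWith c [] X = X
joinWith c (g ∷ gs) X = g ++ c ∷ joinWith c gs X

replicate-joinWith : ∀ c n X → replicate n c ++ X ≡ joinWith c (replicate n []) X
replicate-joinWith c zero X = refl
replicate-joinWith c (suc n) X = cong (c ∷_) (replicate-joinWith c n X)

replicate-∷ʳ : ∀ n (c : ℕ) → replicate n c ++ [ c ] ≡ c ∷ replicate n c
replicate-∷ʳ zero c = refl
replicate-∷ʳ (suc n) c = cong (c ∷_) (replicate-∷ʳ n c)

split-unique : ∀ (c : ℕ) xs ys xs′ ys′ → c ∉ xs → c ∉ xs′ → xs ++ c ∷ ys ≡ xs′ ++ c ∷ ys′ → xs ≡ xs′ × ys ≡ ys′
split-unique c [] ys [] ys′ _ _ eq = refl , proj₂ (∷-injective eq)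
split-unique c [] ys (x ∷ xs′) ys′ _ c∉ eq with refl , _ ← ∷-injective eq = ⊥-elim (c∉ (here refl))
split-unique c (x ∷ xs) ys [] ys′ c∉ _ eq with refl , _ ← ∷-injective eq = ⊥-elim (c∉ (here refl))
split-unique c (x ∷ xs) ys (x′ ∷ xs′) ys′ c∉ c∉′ eq
  with refl , eq′ ← ∷-injective eq
  with refl , rest ← split-unique c xs ys xs′ ys′ (c∉ ∘ there) (c∉′ ∘ there) eq′
  = refl , rest

joinWith-unique : ∀ c gs X gs′ X′ → length gs ≡ length gs′ → All (c ∉_) gs → All (c ∉_) gs′ →
                  joinWith c gs X ≡ joinWith c gs′ X′ → gs ≡ gs′ × X ≡ X′
joinWith-unique c [] X [] X′ _ _ _ eq = refl , eq
joinWith-unique c (g ∷ gs) X (g′ ∷ gs′) X′ len (c∉g ∷ c∉gs) (c∉g′ ∷ c∉gs′) eq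
  with refl , eq′ ← split-unique c g _ g′ _ c∉g c∉g′ eq
  with refl , rest ← joinWith-unique c gs X gs′ X′ (suc-injective len) c∉gs c∉gs′ eq′
  = refl , rest

split-at : ∀ m j σ → count m σ ≡ j → ∃₂ λ gs R → σ ≡ joinWith m gs R × length gs ≡ j × All (m ∉_) gs × m ∉ R
split-at m zero σ none = [] , σ , refl , refl , [] , count≡0⇒∉ none
split-at m (suc j) σ occurrences
  with as , bs , refl , m∉as ← first-split m σ (count>0⇒∈ (subst (0 <_) (sym occurrences) (s≤s z≤n)))
  with gs , R , refl , len , m∉gs , m∉R ← split-at m j bs (suc-injective (trans (sym (count-first m as bs m∉as)) occurrences))
  = as ∷ gs , R , refl , cong suc len , m∉as ∷ m∉gs , m∉R

joinWith-suffix : ∀ m gs R → ∃ λ P → joinWith m gs R ≡ P ++ R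
joinWith-suffix m [] R = [] , refl
joinWith-suffix m (g ∷ gs) R with P , eq ← joinWith-suffix m gs R =
  g ++ m ∷ P , trans (cong (λ w → g ++ m ∷ w) eq) (sym (++-assoc g (m ∷ P) R))

last∈suffix : ∀ xs (m : ℕ) ys r R → xs ++ [ m ] ≡ ys ++ r ∷ R → m ∈ r ∷ R
last∈suffix [] m [] r R eq = here (∷-injectiveˡ eq)
last∈suffix [] m (_ ∷ []) r R eq with () ← ∷-injectiveʳ eq
last∈suffix [] m (_ ∷ _ ∷ _) r R eq with () ← ∷-injectiveʳ eq
last∈suffix (x ∷ xs) m [] r R eq = there (subst (m ∈_) (∷-injectiveʳ eq) (∈-++⁺ʳ xs (here refl)))
last∈suffix (x ∷ xs) m (y ∷ ys) r R eq = last∈suffix xs m ys r R (∷-injectiveʳ eq)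

joinWith-∷ʳ : ∀ xs m gs R → xs ++ [ m ] ≡ joinWith m gs R → m ∉ R → R ≡ []
joinWith-∷ʳ xs m gs [] _ _ = refl
joinWith-∷ʳ xs m gs (r ∷ R) eq m∉R with P , eq′ ← joinWith-suffix m gs (r ∷ R) =
  ⊥-elim (m∉R (last∈suffix xs m P r R (trans eq eq′)))

length-++-∷ : ∀ xs (y : ℕ) ys → length (xs ++ y ∷ ys) ≡ suc (length xs + length ys)
length-++-∷ xs y ys = trans (length-++ xs) (+-suc (length xs) (length ys))

length-gaps< : ∀ m gs R → All (λ g → length g < length (joinWith m gs R)) gs
length-gaps< m [] R = []
length-gaps< m (g ∷ gs) R =
  subst (length g <_) (sym (length-++-∷ g m _)) (s≤s (m≤m+n _ _))
  ∷ All.map (λ g< → <-trans g< (subst (length (joinWith m gs R) <_) (sym (length-++-∷ g m _)) (s≤s (m≤n+m _ _))))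
            (length-gaps< m gs R)

length-rest≤ : ∀ m gs R → length R ≤ length (joinWith m gs R)
length-rest≤ m [] R = ≤-refl
length-rest≤ m (g ∷ gs) R =
  ≤-trans (length-rest≤ m gs R) (subst (length (joinWith m gs R) ≤_) (sym (length-++-∷ g m _)) (≤-trans (m≤n+m _ _) (n≤1+n _)))

length-rest< : ∀ m gs R → 0 < length gs → length R < length (joinWith m gs R)
length-rest< m (g ∷ gs) R _ =
  <-≤-trans (s≤s (length-rest≤ m gs R)) (subst (suc (length (joinWith m gs R)) ≤_) (sym (length-++-∷ g m _)) (s≤s (m≤n+m _ _)))

separators-base : ∀ K l a → K * l + a ≡ 1 * a + K * (l + 0)
separators-base = solve 3 (λ K l a → K :* l :+ a := con 1 :* a :+ K :* (l :+ con 0)) refl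

separators-step : ∀ K l a J n L → J + a ≡ n * a + K * L → K * l + (a + J) + a ≡ suc n * a + K * (l + L)
separators-step K l a J n L hyp = begin
  K * l + (a + J) + a         ≡⟨ solve 4 (λ K l a J → K :* l :+ (a :+ J) :+ a := a :+ K :* l :+ (J :+ a)) refl K l a J ⟩
  a + K * l + (J + a)         ≡⟨ cong (a + K * l +_) hyp ⟩
  a + K * l + (n * a + K * L) ≡⟨ solve 5 (λ K l a n L → a :+ K :* l :+ (n :* a :+ K :* L) := (con 1 :+ n) :* a :+ K :* (l :+ L)) refl K l a n L ⟩
  suc n * a + K * (l + L)     ∎
  where open ≡-Reasoning

module Correspondence (k′ : ℕ) where

  K : ℕ
  K = suc k′

  -- Words of trees

  mutual
    nodeWord : ENode → List ℕ
    nodeWord e = body e ++ [ rootLabel e ]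

    body : ENode → List ℕ
    body (enode c []) = replicate k′ c
    body (enode c (o ∷ os)) = joinChildren c o os

    joinChildren : ℕ → ONode → List ONode → List ℕ
    joinChildren c o [] = childWord o
    joinChildren c o (o′ ∷ os) = childWord o ++ c ∷ joinChildren c o′ os

    childWord : ONode → List ℕ
    childWord (onode es) = forestWord es

    forestWord : List ENode → List ℕ
    forestWord [] = []
    forestWord (e ∷ es) = nodeWord e ++ forestWord es

  root∈labels : ∀ e → rootLabel e ∈ labelsE e
  root∈labels (enode c cs) = here refl

  treeWord : ENode → List ℕ
  treeWord e = rootLabel e ∷ body e

  gaps : ENode → List (List ℕ)
  gaps (enode c []) = replicate K []
  gaps (enode c (o ∷ os)) = map childWord (o ∷ os)

  joinChildren-joinWith : ∀ c o os X → joinChildren c o os ++ c ∷ X ≡ joinWith c (map childWord (o ∷ os)) X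
  joinChildren-joinWith c o [] X = refl
  joinChildren-joinWith c o (o′ ∷ os) X =
    trans (++-assoc (childWord o) _ _) (cong (λ w → childWord o ++ c ∷ w) (joinChildren-joinWith c o′ os X))

  nodeWord-gaps : ∀ e X → nodeWord e ++ X ≡ joinWith (rootLabel e) (gaps e) X
  nodeWord-gaps (enode c []) X = trans (cong (_++ X) (replicate-∷ʳ k′ c)) (replicate-joinWith c K X)
  nodeWord-gaps (enode c (o ∷ os)) X = trans (++-assoc (joinChildren c o os) [ c ] X) (joinChildren-joinWith c o os X)

  mutual
    PrunedE : ENode → Set
    PrunedE (enode c []) = ⊤
    PrunedE (enode c (o ∷ os)) = (length (o ∷ os) ≡ K) × (allLeaves (o ∷ os) ≡ false) × PrunedOs (o ∷ os)

    PrunedOs : List ONode → Set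
    PrunedOs [] = ⊤
    PrunedOs (o ∷ os) = PrunedO o × PrunedOs os

    PrunedO : ONode → Set
    PrunedO (onode es) = PrunedEs es

    PrunedEs : List ENode → Set
    PrunedEs [] = ⊤
    PrunedEs (e ∷ es) = PrunedE e × PrunedEs es

  mutual
    unpruneE : ENode → ENode
    unpruneE (enode c []) = enode c (replicate K (onode []))
    unpruneE (enode c (o ∷ os)) = enode c (unpruneOs (o ∷ os))

    unpruneOs : List ONode → List ONode
    unpruneOs [] = []
    unpruneOs (o ∷ os) = unpruneO o ∷ unpruneOs os

    unpruneO : ONode → ONode
    unpruneO (onode es) = onode (unpruneEs es)

    unpruneEs : List ENode → List ENode
    unpruneEs [] = []
    unpruneEs (e ∷ es) = unpruneE e ∷ unpruneEs es

  length-unpruneOs : ∀ os → length (unpruneOs os) ≡ length os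
  length-unpruneOs [] = refl
  length-unpruneOs (o ∷ os) = cong suc (length-unpruneOs os)

  allLeaves-unpruneOs : ∀ os → allLeaves (unpruneOs os) ≡ allLeaves os
  allLeaves-unpruneOs [] = refl
  allLeaves-unpruneOs (onode [] ∷ os) = allLeaves-unpruneOs os
  allLeaves-unpruneOs (onode (_ ∷ _) ∷ os) = refl

  allLeaves-replicate : ∀ n → allLeaves (replicate n (onode [])) ≡ true
  allLeaves-replicate zero = refl
  allLeaves-replicate (suc n) = allLeaves-replicate n

  evenKary-leaves : ∀ n → EvenKaryOs K (replicate n (onode []))
  evenKary-leaves zero = tt
  evenKary-leaves (suc n) = tt , evenKary-leaves n

  mutual
    evenKary-unpruneE : ∀ e → PrunedE e → EvenKaryE K (unpruneE e)
    evenKary-unpruneE (enode c []) _ = length-replicate K , evenKary-leaves K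
    evenKary-unpruneE (enode c (o ∷ os)) (len , _ , p) =
      trans (length-unpruneOs (o ∷ os)) len , evenKary-unpruneOs (o ∷ os) p

    evenKary-unpruneOs : ∀ os → PrunedOs os → EvenKaryOs K (unpruneOs os)
    evenKary-unpruneOs [] _ = tt
    evenKary-unpruneOs (o ∷ os) (p , ps) = evenKary-unpruneO o p , evenKary-unpruneOs os ps

    evenKary-unpruneO : ∀ o → PrunedO o → EvenKaryO K (unpruneO o)
    evenKary-unpruneO (onode es) p = evenKary-unpruneEs es p

    evenKary-unpruneEs : ∀ es → PrunedEs es → EvenKaryEs K (unpruneEs es)
    evenKary-unpruneEs [] _ = tt
    evenKary-unpruneEs (e ∷ es) (p , ps) = evenKary-unpruneE e p , evenKary-unpruneEs es ps

  if-false : ∀ {A : Set} b {x y : A} → b ≡ false → (if b then x else y) ≡ y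
  if-false false refl = refl

  mutual
    prune-unpruneE : ∀ e → PrunedE e → pruneE (unpruneE e) ≡ e
    prune-unpruneE (enode c []) _ rewrite allLeaves-replicate K = refl
    prune-unpruneE (enode c (o ∷ os)) (_ , notLeaves , p) =
      trans (if-false (allLeaves (unpruneOs (o ∷ os))) (trans (allLeaves-unpruneOs (o ∷ os)) notLeaves))
            (cong (enode c) (prune-unpruneOs (o ∷ os) p))

    prune-unpruneOs : ∀ os → PrunedOs os → pruneOs (unpruneOs os) ≡ os
    prune-unpruneOs [] _ = refl
    prune-unpruneOs (o ∷ os) (p , ps) = cong₂ _∷_ (prune-unpruneO o p) (prune-unpruneOs os ps)

    prune-unpruneO : ∀ o → PrunedO o → pruneO (unpruneO o) ≡ o
    prune-unpruneO (onode es) p = cong onode (prune-unpruneEs es p)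

    prune-unpruneEs : ∀ es → PrunedEs es → pruneEs (unpruneEs es) ≡ es
    prune-unpruneEs [] _ = refl
    prune-unpruneEs (e ∷ es) (p , ps) = cong₂ _∷_ (prune-unpruneE e p) (prune-unpruneEs es ps)

  PrunedE⇒IsPrunedEvenKary : ∀ e → PrunedE e → IsPrunedEvenKary K e
  PrunedE⇒IsPrunedEvenKary e p = unpruneE e , evenKary-unpruneE e p , prune-unpruneE e p

  length-pruneOs : ∀ os → length (pruneOs os) ≡ length os
  length-pruneOs [] = refl
  length-pruneOs (o ∷ os) = cong suc (length-pruneOs os)

  allLeaves-pruneOs : ∀ os → allLeaves (pruneOs os) ≡ allLeaves os
  allLeaves-pruneOs [] = refl
  allLeaves-pruneOs (onode [] ∷ os) = allLeaves-pruneOs os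
  allLeaves-pruneOs (onode (_ ∷ _) ∷ os) = refl

  mutual
    pruned-pruneE : ∀ e → EvenKaryE K e → PrunedE (pruneE e)
    pruned-pruneE (enode c cs) (len , ek) with allLeaves cs in leaves
    ... | true = tt
    pruned-pruneE (enode c (o ∷ os)) (len , ek) | false =
      trans (length-pruneOs (o ∷ os)) len , trans (allLeaves-pruneOs (o ∷ os)) leaves , pruned-pruneOs (o ∷ os) ek

    pruned-pruneOs : ∀ os → EvenKaryOs K os → PrunedOs (pruneOs os)
    pruned-pruneOs [] _ = tt
    pruned-pruneOs (o ∷ os) (ek , eks) = pruned-pruneO o ek , pruned-pruneOs os eks

    pruned-pruneO : ∀ o → EvenKaryO K o → PrunedO (pruneO o)
    pruned-pruneO (onode es) ek = pruned-pruneEs es ek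

    pruned-pruneEs : ∀ es → EvenKaryEs K es → PrunedEs (pruneEs es)
    pruned-pruneEs [] _ = tt
    pruned-pruneEs (e ∷ es) (ek , eks) = pruned-pruneE e ek , pruned-pruneEs es eks

  IsPrunedEvenKary⇒PrunedE : ∀ e → IsPrunedEvenKary K e → PrunedE e
  IsPrunedEvenKary⇒PrunedE _ (e , ek , refl) = pruned-pruneE e ek

  mutual
    ∈-nodeWord⁻ : ∀ {v} e → v ∈ nodeWord e → v ∈ labelsE e
    ∈-nodeWord⁻ (enode c cs) v∈ with ∈-++⁻ (body (enode c cs)) v∈
    ... | inj₂ (here refl) = here refl
    ... | inj₁ v∈body with ∈-body⁻ c cs v∈body
    ...   | inj₁ refl = here refl
    ...   | inj₂ v∈cs = there v∈cs

    ∈-body⁻ : ∀ {v} c cs → v ∈ body (enode c cs) → v ≡ c ⊎ v ∈ labelsOs cs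
    ∈-body⁻ c [] v∈ = inj₁ (∈-replicate⁻ k′ v∈)
    ∈-body⁻ c (o ∷ os) v∈ = ∈-joinChildren⁻ c o os v∈

    ∈-joinChildren⁻ : ∀ {v} c o os → v ∈ joinChildren c o os → v ≡ c ⊎ v ∈ labelsOs (o ∷ os)
    ∈-joinChildren⁻ c o [] v∈ = inj₂ (∈-++⁺ˡ (∈-childWord⁻ o v∈))
    ∈-joinChildren⁻ c o (o′ ∷ os) v∈ with ∈-++⁻ (childWord o) v∈
    ... | inj₁ p = inj₂ (∈-++⁺ˡ (∈-childWord⁻ o p))
    ... | inj₂ (here refl) = inj₁ refl
    ... | inj₂ (there p) = Sum.map₂ (∈-++⁺ʳ (labelsO o)) (∈-joinChildren⁻ c o′ os p)

    ∈-childWord⁻ : ∀ {v} o → v ∈ childWord o → v ∈ labelsO o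
    ∈-childWord⁻ (onode es) = ∈-forestWord⁻ es

    ∈-forestWord⁻ : ∀ {v} es → v ∈ forestWord es → v ∈ labelsEs es
    ∈-forestWord⁻ (e ∷ es) v∈ with ∈-++⁻ (nodeWord e) v∈
    ... | inj₁ p = ∈-++⁺ˡ (∈-nodeWord⁻ e p)
    ... | inj₂ p = ∈-++⁺ʳ (labelsE e) (∈-forestWord⁻ es p)

  mutual
    ∈-nodeWord⁺ : ∀ {v} e → v ∈ labelsE e → v ∈ nodeWord e
    ∈-nodeWord⁺ (enode c cs) (here refl) = ∈-++⁺ʳ (body (enode c cs)) (here refl)
    ∈-nodeWord⁺ (enode c (o ∷ os)) (there p) = ∈-++⁺ˡ (∈-joinChildren⁺ c o os p)

    ∈-joinChildren⁺ : ∀ {v} c o os → v ∈ labelsOs (o ∷ os) → v ∈ joinChildren c o os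
    ∈-joinChildren⁺ c o [] p with ∈-++⁻ (labelsO o) p
    ... | inj₁ q = ∈-childWord⁺ o q
    ∈-joinChildren⁺ c o (o′ ∷ os) p with ∈-++⁻ (labelsO o) p
    ... | inj₁ q = ∈-++⁺ˡ (∈-childWord⁺ o q)
    ... | inj₂ q = ∈-++⁺ʳ (childWord o) (there (∈-joinChildren⁺ c o′ os q))

    ∈-childWord⁺ : ∀ {v} o → v ∈ labelsO o → v ∈ childWord o
    ∈-childWord⁺ (onode es) = ∈-forestWord⁺ es

    ∈-forestWord⁺ : ∀ {v} es → v ∈ labelsEs es → v ∈ forestWord es
    ∈-forestWord⁺ (e ∷ es) p with ∈-++⁻ (labelsE e) p
    ... | inj₁ q = ∈-++⁺ˡ (∈-nodeWord⁺ e q)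
    ... | inj₂ q = ∈-++⁺ʳ (nodeWord e) (∈-forestWord⁺ es q)

  All-joinChildren : ∀ {P : ℕ → Set} {c} o os → P c → All P (labelsOs (o ∷ os)) → All P (joinChildren c o os)
  All-joinChildren {c = c} o os pc ps = All.tabulate (Sum.[ (λ { refl → pc }) , All.lookup ps ] ∘ ∈-joinChildren⁻ c o os)

  root-≤-labels : ∀ e → IncreasingE e → All (rootLabel e ≤_) (labelsE e)
  root-≤-labels (enode c cs) (c<cs , _) = ≤-refl ∷ All.map <⇒≤ c<cs

  labels-above : ∀ {p} es → Linked _<_ (p ∷ map rootLabel es) → IncreasingEs es → All (p <_) (labelsEs es)
  labels-above [] _ _ = []
  labels-above (e ∷ es) (p<e ∷ linked) (inc , incs) =
    All.++⁺ (All.map (<-≤-trans p<e) (root-≤-labels e inc)) (All.map (<-trans p<e) (labels-above es linked incs))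

  mutual
    count-nodeWord : ∀ v e → PrunedE e → count v (nodeWord e) ≡ K * count v (labelsE e)
    count-nodeWord v (enode c []) _ = trans (cong (count v) (replicate-∷ʳ k′ c)) (count-replicate v K c)
    count-nodeWord v (enode c (o ∷ os)) (len , _ , p) = begin
      count v (joinChildren c o os ++ [ c ])                          ≡⟨ count-++ v (joinChildren c o os) [ c ] ⟩
      count v (joinChildren c o os) + count v [ c ]                   ≡⟨ count-joinChildren v c o os p ⟩
      length (o ∷ os) * count v [ c ] + K * count v (labelsOs (o ∷ os)) ≡⟨ cong (λ n → n * count v [ c ] + K * count v (labelsOs (o ∷ os))) len ⟩
      K * count v [ c ] + K * count v (labelsOs (o ∷ os))             ≡⟨ *-distribˡ-+ K (count v [ c ]) (count v (labelsOs (o ∷ os))) ⟨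
      K * (count v [ c ] + count v (labelsOs (o ∷ os)))               ≡⟨ cong (K *_) (count-∷ v c _) ⟨
      K * count v (c ∷ labelsOs (o ∷ os))                             ∎
      where open ≡-Reasoning

    count-joinChildren : ∀ v c o os → PrunedOs (o ∷ os) →
      count v (joinChildren c o os) + count v [ c ] ≡ length (o ∷ os) * count v [ c ] + K * count v (labelsOs (o ∷ os))
    count-joinChildren v c o [] (p , _) = begin
      count v (childWord o) + a         ≡⟨ cong (_+ a) (count-childWord v o p) ⟩
      K * l + a                         ≡⟨ separators-base K l a ⟩
      1 * a + K * (l + 0)               ≡⟨ cong (λ x → 1 * a + K * x) (trans (count-++ v (labelsO o) []) (cong (l +_) (count-[] v))) ⟨
      1 * a + K * count v (labelsO o ++ []) ∎
      where
      open ≡-Reasoning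
      a = count v [ c ]
      l = count v (labelsO o)
    count-joinChildren v c o (o′ ∷ os) (p , ps) = begin
      count v (childWord o ++ c ∷ joinChildren c o′ os) + a
        ≡⟨ cong (_+ a) (trans (count-++ v (childWord o) _) (cong₂ _+_ (count-childWord v o p) (count-∷ v c _))) ⟩
      K * l + (a + J) + a               ≡⟨ separators-step K l a J n L (count-joinChildren v c o′ os ps) ⟩
      suc n * a + K * (l + L)           ≡⟨ cong (λ x → suc n * a + K * x) (count-++ v (labelsO o) _) ⟨
      suc n * a + K * count v (labelsO o ++ labelsOs (o′ ∷ os)) ∎
      where
      open ≡-Reasoning
      a = count v [ c ]
      l = count v (labelsO o)
      J = count v (joinChildren c o′ os)
      n = length (o′ ∷ os)
      L = count v (labelsOs (o′ ∷ os))

    count-childWord : ∀ v o → PrunedO o → count v (childWord o) ≡ K * count v (labelsO o)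
    count-childWord v (onode es) p = count-forestWord v es p

    count-forestWord : ∀ v es → PrunedEs es → count v (forestWord es) ≡ K * count v (labelsEs es)
    count-forestWord v [] _ = trans (count-[] v) (sym (trans (cong (K *_) (count-[] v)) (*-zeroʳ K)))
    count-forestWord v (e ∷ es) (p , ps) = begin
      count v (nodeWord e ++ forestWord es)                    ≡⟨ count-++ v (nodeWord e) (forestWord es) ⟩
      count v (nodeWord e) + count v (forestWord es)           ≡⟨ cong₂ _+_ (count-nodeWord v e p) (count-forestWord v es ps) ⟩
      K * count v (labelsE e) + K * count v (labelsEs es)      ≡⟨ *-distribˡ-+ K (count v (labelsE e)) (count v (labelsEs es)) ⟨
      K * (count v (labelsE e) + count v (labelsEs es))        ≡⟨ cong (K *_) (count-++ v (labelsE e) (labelsEs es)) ⟨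
      K * count v (labelsE e ++ labelsEs es)                   ∎
      where open ≡-Reasoning

  count-treeWord : ∀ v T → PrunedE T → count v (treeWord T) ≡ K * count v (labelsE T)
  count-treeWord v T p = trans (sym (count-∷ʳ v (rootLabel T) (body T))) (count-nodeWord v T p)

  root-≤-body : ∀ e → IncreasingE e → All (rootLabel e ≤_) (body e)
  root-≤-body (enode c []) _ = All.replicate⁺ k′ ≤-refl
  root-≤-body (enode c (o ∷ os)) (c<cs , _) = All-joinChildren o os ≤-refl (All.map <⇒≤ c<cs)

  mutual
    stirling-nodeWord : ∀ e → IncreasingE e → Distinct (labelsE e) → Stirling (nodeWord e)
    stirling-nodeWord (enode c []) _ _ = Stirling-∷ʳ (replicate k′ c) (All.replicate⁺ k′ ≤-refl) (Stirling-replicate k′ c)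
    stirling-nodeWord e@(enode c (o ∷ os)) inc@(c<cs , incs) distinct =
      Stirling-∷ʳ (joinChildren c o os) (root-≤-body e inc) (stirling-joinChildren c o os c<cs incs (Distinct-++ʳ [ c ] distinct))

    stirling-joinChildren : ∀ c o os → All (c <_) (labelsOs (o ∷ os)) → IncreasingOs (o ∷ os) →
                            Distinct (labelsOs (o ∷ os)) → Stirling (joinChildren c o os)
    stirling-joinChildren c o [] _ (inc , _) distinct = stirling-childWord o inc (Distinct-++ˡ (labelsO o) distinct)
    stirling-joinChildren c o (o′ ∷ os) c<cs (inc , incs) distinct =
      Stirling-++ (childWord o) (c ∷ joinChildren c o′ os)
        (stirling-childWord o inc (Distinct-++ˡ (labelsO o) distinct))
        (Stirling-∷ (joinChildren c o′ os) (All-joinChildren o′ os ≤-refl (All.map <⇒≤ c<rest))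
                    (stirling-joinChildren c o′ os c<rest incs (Distinct-++ʳ (labelsO o) distinct)))
        disjoint
      where
      c<rest = All.++⁻ʳ (labelsO o) c<cs
      disjoint : ∀ {v} → v ∈ childWord o → v ∉ c ∷ joinChildren c o′ os
      disjoint v∈ (here refl) = <-irrefl refl (All.lookup (All.++⁻ˡ (labelsO o) c<cs) (∈-childWord⁻ o v∈))
      disjoint v∈ (there v∈′) with ∈-joinChildren⁻ c o′ os v∈′
      ... | inj₁ refl = <-irrefl refl (All.lookup (All.++⁻ˡ (labelsO o) c<cs) (∈-childWord⁻ o v∈))
      ... | inj₂ v∈rest = Distinct-++⇒disjoint (labelsO o) distinct (∈-childWord⁻ o v∈) v∈rest

    stirling-childWord : ∀ o → IncreasingO o → Distinct (labelsO o) → Stirling (childWord o)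
    stirling-childWord (onode es) (_ , incs) = stirling-forestWord es incs

    stirling-forestWord : ∀ es → IncreasingEs es → Distinct (labelsEs es) → Stirling (forestWord es)
    stirling-forestWord [] _ _ = tt
    stirling-forestWord (e ∷ es) (inc , incs) distinct =
      Stirling-++ (nodeWord e) (forestWord es)
        (stirling-nodeWord e inc (Distinct-++ˡ (labelsE e) distinct))
        (stirling-forestWord es incs (Distinct-++ʳ (labelsE e) distinct))
        (λ v∈ v∈′ → Distinct-++⇒disjoint (labelsE e) distinct (∈-nodeWord⁻ e v∈) (∈-forestWord⁻ es v∈′))

  stirling-treeWord : ∀ T → IncreasingE T → Distinct (labelsE T) → Stirling (treeWord T)
  stirling-treeWord T inc distinct =
    Stirling-∷ (body T) (root-≤-body T inc) (Stirling-++⁻ˡ (body T) [ rootLabel T ] (stirling-nodeWord T inc distinct))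

  childWord-head : ∀ e es → ∃₂ λ d ds → childWord (onode (e ∷ es)) ≡ d ∷ ds
  childWord-head e es with body e
  ... | [] = rootLabel e , forestWord es , refl
  ... | d ∷ ds = d , (ds ++ [ rootLabel e ]) ++ forestWord es , refl

  childWord-above : ∀ {c} e es → All (c <_) (labelsEs (e ∷ es)) → ∃₂ λ d ds → childWord (onode (e ∷ es)) ≡ d ∷ ds × c < d
  childWord-above e es c< with d , ds , eq ← childWord-head e es =
    d , ds , eq , All.lookup c< (∈-childWord⁻ (onode (e ∷ es)) (subst (d ∈_) (sym eq) (here refl)))

  linked-above : ∀ {c} es → All (c <_) (labelsEs es) → Linked _<_ (map rootLabel es) → Linked _<_ (c ∷ map rootLabel es)
  linked-above [] _ _ = [-]
  linked-above (enode d cs ∷ es) (c<d ∷ _) linked = c<d ∷ linked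

  lastRoot : ℕ → List ENode → ℕ
  lastRoot p [] = p
  lastRoot p (e ∷ es) = lastRoot (rootLabel e) es

  lastRoot-All : ∀ {P : ℕ → Set} {p} es → P p → All P (labelsEs es) → P (lastRoot p es)
  lastRoot-All [] pp _ = pp
  lastRoot-All (enode c cs ∷ es) _ (pc ∷ ps) = lastRoot-All es pc (All.++⁻ʳ (labelsOs cs) ps)

  -- Before the j-th separator c stands the word of the first non-leaf child, which begins above c.
  plateau-broken : ∀ c os r j → length os ≡ j → allLeaves os ≡ false → All (c <_) (labelsOs os) →
                   allEq c (take j (joinWith c (map childWord os) r)) ≡ false
  plateau-broken c (onode [] ∷ os) r (suc j) len notLeaves c<
    rewrite T⇒≡true (≡⇒≡ᵇ c c refl) = plateau-broken c os r j (suc-injective len) notLeaves c<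
  plateau-broken c (onode (e ∷ es) ∷ os) r (suc j) _ _ c<
    with d , ds , eq , c<d ← childWord-above e es (All.++⁻ˡ (labelsEs (e ∷ es)) c<) =
    subst (λ w → allEq c (take (suc j) (w ++ c ∷ joinWith c (map childWord os) r)) ≡ false) (sym eq)
          (cong (_∧ allEq c (take j (ds ++ c ∷ joinWith c (map childWord os) r))) (≢⇒≡ᵇ≡false (λ d≡c → <-irrefl (sym d≡c) c<d)))

  mutual
    ap-nodeWord : ∀ {p} e r → PrunedE e → IncreasingE e → p < rootLabel e →
                  ap K (p ∷ nodeWord e ++ r) ≡ lleafE e + ap K (rootLabel e ∷ r)
    ap-nodeWord {p} (enode c []) r _ _ p<c =
      trans (cong (λ w → ap K (p ∷ w)) (trans (nodeWord-gaps (enode c []) r) (sym (replicate-joinWith c K r))))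
            (ap-plateau-start k′ r p<c)
    ap-nodeWord {p} e@(enode c (onode [] ∷ os)) r (len , notLeaves , _ , pruned) (c< , _ , incs) p<c = begin
      ap K (p ∷ nodeWord e ++ r)                         ≡⟨ cong (λ w → ap K (p ∷ w)) (nodeWord-gaps e r) ⟩
      (if isAPStart K (p ∷ c ∷ gapsWord) then 1 else 0) + ap K (c ∷ gapsWord)
                                                         ≡⟨ cong (_+ ap K (c ∷ gapsWord)) noPlateau ⟩
      ap K (c ∷ gapsWord)                                ≡⟨ ap-gaps c os r pruned incs c< ⟩
      lleafOs os + ap K (c ∷ r)                          ∎
      where
      open ≡-Reasoning
      gapsWord = joinWith c (map childWord os) r
      noPlateau : (if isAPStart K (p ∷ c ∷ gapsWord) then 1 else 0) ≡ 0
      noPlateau rewrite T⇒≡true (≡⇒≡ᵇ c c refl) | plateau-broken c os r k′ (suc-injective len) notLeaves c<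
                      | ∧-zeroʳ (K ≤ᵇ length (c ∷ gapsWord)) | ∧-zeroʳ (p <ᵇ c) = refl
    ap-nodeWord {p} e@(enode c (o@(onode (e₁ ∷ es)) ∷ os)) r (_ , _ , pruned₁ , pruned) (c< , (linked , incs₁) , incs) p<c = begin
      ap K (p ∷ nodeWord e ++ r)                              ≡⟨ cong (λ w → ap K (p ∷ w)) (nodeWord-gaps e r) ⟩
      ap K (p ∷ forestWord (e₁ ∷ es) ++ c ∷ gapsWord)        ≡⟨ ap-forestWord p (e₁ ∷ es) (c ∷ gapsWord) pruned₁ p-linked incs₁ ⟩
      lleafEs (e₁ ∷ es) + ap K (lastRoot p (e₁ ∷ es) ∷ c ∷ gapsWord)
                                                              ≡⟨ cong (lleafEs (e₁ ∷ es) +_) (ap-∷-≥ K gapsWord c≤last) ⟩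
      lleafEs (e₁ ∷ es) + ap K (c ∷ gapsWord)                 ≡⟨ cong (lleafEs (e₁ ∷ es) +_) (ap-gaps c os r pruned incs c<rest) ⟩
      lleafEs (e₁ ∷ es) + (lleafOs os + ap K (c ∷ r))         ≡⟨ +-assoc (lleafEs (e₁ ∷ es)) _ _ ⟨
      lleafEs (e₁ ∷ es) + lleafOs os + ap K (c ∷ r)           ∎
      where
      open ≡-Reasoning
      gapsWord = joinWith c (map childWord os) r
      c<first = All.++⁻ˡ (labelsEs (e₁ ∷ es)) c<
      c<rest = All.++⁻ʳ (labelsEs (e₁ ∷ es)) c<
      p-linked = linked-above (e₁ ∷ es) (All.map (<-trans p<c) c<first) linked
      c≤last : c ≤ lastRoot p (e₁ ∷ es)
      c≤last with c<e₁ ∷ _ ← linked-above (e₁ ∷ es) c<first linked =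
        lastRoot-All es (<⇒≤ c<e₁) (All.map <⇒≤ (All.++⁻ʳ (labelsE e₁) c<first))

    ap-gaps : ∀ c os r → PrunedOs os → IncreasingOs os → All (c <_) (labelsOs os) →
              ap K (c ∷ joinWith c (map childWord os) r) ≡ lleafOs os + ap K (c ∷ r)
    ap-gaps c [] r _ _ _ = refl
    ap-gaps c (onode es ∷ os) r (pruned₁ , pruned) ((linked , incs₁) , incs) c< = begin
      ap K (c ∷ forestWord es ++ c ∷ gapsWord)            ≡⟨ ap-forestWord c es (c ∷ gapsWord) pruned₁ (linked-above es c<first linked) incs₁ ⟩
      lleafEs es + ap K (lastRoot c es ∷ c ∷ gapsWord)    ≡⟨ cong (lleafEs es +_) (ap-∷-≥ K gapsWord (lastRoot-All es ≤-refl (All.map <⇒≤ c<first))) ⟩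
      lleafEs es + ap K (c ∷ gapsWord)                     ≡⟨ cong (lleafEs es +_) (ap-gaps c os r pruned incs (All.++⁻ʳ (labelsEs es) c<)) ⟩
      lleafEs es + (lleafOs os + ap K (c ∷ r))             ≡⟨ +-assoc (lleafEs es) _ _ ⟨
      lleafEs es + lleafOs os + ap K (c ∷ r)               ∎
      where
      open ≡-Reasoning
      gapsWord = joinWith c (map childWord os) r
      c<first = All.++⁻ˡ (labelsEs es) c<

    ap-forestWord : ∀ p es r → PrunedEs es → Linked _<_ (p ∷ map rootLabel es) → IncreasingEs es →
                    ap K (p ∷ forestWord es ++ r) ≡ lleafEs es + ap K (lastRoot p es ∷ r)
    ap-forestWord p [] r _ _ _ = refl
    ap-forestWord p (e ∷ es) r (pruned , pruneds) (p<e ∷ linked) (inc , incs) = begin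
      ap K (p ∷ (nodeWord e ++ forestWord es) ++ r)              ≡⟨ cong (λ w → ap K (p ∷ w)) (++-assoc (nodeWord e) _ r) ⟩
      ap K (p ∷ nodeWord e ++ forestWord es ++ r)                ≡⟨ ap-nodeWord e (forestWord es ++ r) pruned inc p<e ⟩
      lleafE e + ap K (rootLabel e ∷ forestWord es ++ r)         ≡⟨ cong (lleafE e +_) (ap-forestWord (rootLabel e) es r pruneds linked incs) ⟩
      lleafE e + (lleafEs es + ap K (lastRoot (rootLabel e) es ∷ r)) ≡⟨ +-assoc (lleafE e) _ _ ⟨
      lleafE e + lleafEs es + ap K (lastRoot (rootLabel e) es ∷ r) ∎
      where open ≡-Reasoning

  ap-treeWord : ∀ c o os → PrunedE (enode c (o ∷ os)) → IncreasingE (enode c (o ∷ os)) →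
                ap K (treeWord (enode c (o ∷ os))) ≡ lleafE (enode c (o ∷ os))
  ap-treeWord c o os (_ , _ , pruned) inc@(c< , incs) = begin
    ap K (c ∷ body N)                         ≡⟨ ap-∷ʳ-≤ K (c ∷ body N) (≤-refl ∷ root-≤-body N inc) ⟨
    ap K (c ∷ nodeWord N)                     ≡⟨ cong (λ w → ap K (c ∷ w)) (trans (sym (++-identityʳ (nodeWord N))) (nodeWord-gaps N [])) ⟩
    ap K (c ∷ joinWith c (gaps N) [])         ≡⟨ ap-gaps c (o ∷ os) [] pruned incs c< ⟩
    lleafOs (o ∷ os) + 0                      ≡⟨ +-identityʳ _ ⟩
    lleafOs (o ∷ os)                          ∎
    where
    open ≡-Reasoning
    N = enode c (o ∷ os)

  joinChildren-head : ∀ c o os → ∃ λ Y → joinChildren c o os ≡ childWord o ++ Y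
  joinChildren-head c o [] = [] , sym (++-identityʳ (childWord o))
  joinChildren-head c o (o′ ∷ os) = c ∷ joinChildren c o′ os , refl

  leaves⇒plateau : ∀ c j o os → All IsLeafO (take j (o ∷ os)) → All (c ≡_) (take j (joinChildren c o os))
  leaves⇒plateau c zero o os _ = []
  leaves⇒plateau c (suc j) (onode []) [] _ = []
  leaves⇒plateau c (suc j) (onode []) (o′ ∷ os) (_ ∷ leaves) = refl ∷ leaves⇒plateau c j o′ os leaves
  leaves⇒plateau c (suc j) (onode (_ ∷ _)) os (() ∷ _)

  plateau⇒leaves : ∀ c j o os → All (c <_) (labelsOs (o ∷ os)) → All (c ≡_) (take j (joinChildren c o os)) →
                   All IsLeafO (take j (o ∷ os))
  plateau⇒leaves c zero o os _ _ = []
  plateau⇒leaves c (suc zero) (onode []) os _ _ = refl ∷ []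
  plateau⇒leaves c (suc (suc j)) (onode []) [] _ _ = refl ∷ []
  plateau⇒leaves c (suc (suc j)) (onode []) (o′ ∷ os) c< (_ ∷ plateau) = refl ∷ plateau⇒leaves c (suc j) o′ os c< plateau
  plateau⇒leaves c (suc j) (onode (e ∷ es)) os c< plateau
    with Y , eqY ← joinChildren-head c (onode (e ∷ es)) os
       | d , ds , eq , c<d ← childWord-above e es (All.++⁻ˡ (labelsEs (e ∷ es)) c<)
    with c≡d ∷ _ ← subst (λ w → All (c ≡_) (take (suc j) w)) (trans eqY (cong (_++ Y) eq)) plateau
    = ⊥-elim (<-irrefl c≡d c<d)

  length-gaps : ∀ e → PrunedE e → length (gaps e) ≡ K
  length-gaps (enode c []) _ = length-replicate K
  length-gaps (enode c (o ∷ os)) (len , _) = trans (length-map childWord (o ∷ os)) len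

  root∉gaps : ∀ e → IncreasingE e → All (rootLabel e ∉_) (gaps e)
  root∉gaps (enode c []) _ = All.replicate⁺ K (λ ())
  root∉gaps (enode c (o ∷ os)) (c< , _) = All.map⁺ (go (o ∷ os) c<)
    where
    go : ∀ os → All (c <_) (labelsOs os) → All (λ o → c ∉ childWord o) os
    go [] _ = []
    go (o ∷ os) c< = (λ c∈ → <-irrefl refl (All.lookup (All.++⁻ˡ (labelsO o) c<) (∈-childWord⁻ o c∈)))
                   ∷ go os (All.++⁻ʳ (labelsO o) c<)

  forestWord-∷≢[] : ∀ e es → forestWord (e ∷ es) ≢ []
  forestWord-∷≢[] e es eq with _ , _ , eq′ ← childWord-head e es with () ← trans (sym eq′) eq

  childWords-leaves : ∀ os n → map childWord os ≡ replicate n [] → allLeaves os ≡ true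
  childWords-leaves [] n _ = refl
  childWords-leaves (onode [] ∷ os) (suc n) eq = childWords-leaves os n (proj₂ (∷-injective eq))
  childWords-leaves (onode (e ∷ es) ∷ os) (suc n) eq = ⊥-elim (forestWord-∷≢[] e es (∷-injectiveˡ eq))

  root∈forestWord : ∀ e es → rootLabel e ∈ forestWord (e ∷ es)
  root∈forestWord e es = ∈-++⁺ˡ (∈-++⁺ʳ (body e) (here refl))

  root-≤-forestWord : ∀ e es → IncreasingO (onode (e ∷ es)) → All (rootLabel e ≤_) (forestWord (e ∷ es))
  root-≤-forestWord e es (linked , inc , incs) = All.tabulate (All.lookup root≤labels ∘ ∈-forestWord⁻ (e ∷ es))
    where root≤labels = All.++⁺ (root-≤-labels e inc) (All.map <⇒≤ (labels-above es linked incs))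

  mutual
    forestWord-injective : ∀ es es′ → PrunedEs es → PrunedEs es′ → IncreasingO (onode es) → IncreasingO (onode es′) →
                           forestWord es ≡ forestWord es′ → es ≡ es′
    forestWord-injective [] [] _ _ _ _ _ = refl
    forestWord-injective [] (e′ ∷ es′) _ _ _ _ eq = ⊥-elim (forestWord-∷≢[] e′ es′ (sym eq))
    forestWord-injective (e ∷ es) [] _ _ _ _ eq = ⊥-elim (forestWord-∷≢[] e es eq)
    forestWord-injective (e@(enode c cs) ∷ es) (e′@(enode c′ cs′) ∷ es′) (p , ps) (p′ , ps′)
                         inc@(linked , i , is) inc′@(linked′ , i′ , is′) eq
      with refl ← ≤-antisym (All.lookup (root-≤-forestWord e es inc) (subst (c′ ∈_) (sym eq) (root∈forestWord e′ es′)))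
                            (All.lookup (root-≤-forestWord e′ es′ inc′) (subst (c ∈_) eq (root∈forestWord e es)))
      with gapsEq , restEq ← joinWith-unique c (gaps e) (forestWord es) (gaps e′) (forestWord es′)
                               (trans (length-gaps e p) (sym (length-gaps e′ p′))) (root∉gaps e i) (root∉gaps e′ i′)
                               (trans (sym (nodeWord-gaps e _)) (trans eq (nodeWord-gaps e′ _)))
      = cong₂ _∷_ (cong (enode c) (gaps-injective c cs cs′ p p′ i i′ gapsEq))
                  (forestWord-injective es es′ ps ps′ (Linked.tail linked , is) (Linked.tail linked′ , is′) restEq)

    gaps-injective : ∀ c cs cs′ → PrunedE (enode c cs) → PrunedE (enode c cs′) →
                     IncreasingE (enode c cs) → IncreasingE (enode c cs′) → gaps (enode c cs) ≡ gaps (enode c cs′) → cs ≡ cs′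
    gaps-injective c [] [] _ _ _ _ _ = refl
    gaps-injective c [] (o ∷ os) _ (_ , notLeaves , _) _ _ eq
      with () ← trans (sym (childWords-leaves (o ∷ os) K (sym eq))) notLeaves
    gaps-injective c (o ∷ os) [] (_ , notLeaves , _) _ _ _ eq
      with () ← trans (sym (childWords-leaves (o ∷ os) K eq)) notLeaves
    gaps-injective c (o ∷ os) (o′ ∷ os′) (_ , _ , p) (_ , _ , p′) (_ , is) (_ , is′) eq =
      childWords-injective (o ∷ os) (o′ ∷ os′) p p′ is is′ eq

    childWords-injective : ∀ os os′ → PrunedOs os → PrunedOs os′ → IncreasingOs os → IncreasingOs os′ →
                           map childWord os ≡ map childWord os′ → os ≡ os′
    childWords-injective [] [] _ _ _ _ _ = refl
    childWords-injective (onode es ∷ os) (onode es′ ∷ os′) (p , ps) (p′ , ps′) (i , is) (i′ , is′) eq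
      with eq₁ , eq₂ ← ∷-injective eq
      = cong₂ _∷_ (cong onode (forestWord-injective es es′ p p′ i i′ eq₁)) (childWords-injective os os′ ps ps′ is is′ eq₂)

  treeWord-injective : ∀ T T′ → PrunedE T → PrunedE T′ → IncreasingE T → IncreasingE T′ → treeWord T ≡ treeWord T′ → T ≡ T′
  treeWord-injective T T′ p p′ i i′ eq with rootEq , bodyEq ← ∷-injective eq =
    ∷-injectiveˡ (forestWord-injective [ T ] [ T′ ] (p , tt) (p′ , tt) ([-] , i , tt) ([-] , i′ , tt)
                   (cong (_++ []) (cong₂ (λ b c → b ++ [ c ]) bodyEq rootEq)))

  firstK-treeWord : ∀ c o os → All (c <_) (labelsOs (o ∷ os)) →
                    FirstKEqual K (treeWord (enode c (o ∷ os))) ⇔ FirstRootChildrenLeaves K (enode c (o ∷ os))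
  firstK-treeWord c o os c< =
    mk⇔ (λ { (_ ∷ plateau) → plateau⇒leaves c k′ o os c< plateau }) (λ leaves → refl ∷ leaves⇒plateau c k′ o os leaves)

  -- Decoding

  Uniform : List ℕ → Set
  Uniform σ = ∀ v → count v σ ≡ 0 ⊎ count v σ ≡ K

  UniformExcept : ℕ → List ℕ → Set
  UniformExcept m σ = ∀ v → v ≢ m → count v σ ≡ 0 ⊎ count v σ ≡ K

  UniformExcept⇒Uniform : ∀ {m σ} → UniformExcept m σ → m ∉ σ → Uniform σ
  UniformExcept⇒Uniform {m} u m∉ v with v ≟ m
  ... | yes refl = inj₁ (∉⇒count≡0 m∉)
  ... | no v≢m = u v v≢m

  UniformExcept-split : ∀ {m} as bs → (∀ {v} → v ∈ as → v ∉ bs) → UniformExcept m (as ++ m ∷ bs) →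
                        UniformExcept m as × UniformExcept m bs
  UniformExcept-split {m} as bs disjoint u = uniform-as , uniform-bs
    where
    total : ∀ {v} → v ≢ m → count v (as ++ m ∷ bs) ≡ count v as + count v bs
    total {v} v≢m = trans (count-++ v as (m ∷ bs)) (cong (count v as +_) (count-there bs v≢m))
    uniform-as : UniformExcept m as
    uniform-as v v≢m with v ∈? as
    ... | no v∉as = inj₁ (∉⇒count≡0 v∉as)
    ... | yes v∈as = subst (λ n → n ≡ 0 ⊎ n ≡ K)
                       (trans (total v≢m) (trans (cong (count v as +_) (∉⇒count≡0 (disjoint v∈as))) (+-identityʳ _)))
                       (u v v≢m)
    uniform-bs : UniformExcept m bs
    uniform-bs v v≢m with v ∈? as
    ... | yes v∈as = inj₁ (∉⇒count≡0 (disjoint v∈as))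
    ... | no v∉as = subst (λ n → n ≡ 0 ⊎ n ≡ K) (trans (total v≢m) (cong (_+ count v bs) (∉⇒count≡0 v∉as))) (u v v≢m)

  WordAbove : ℕ → List ℕ → Set
  WordAbove m g = Stirling g × Uniform g × All (m <_) g

  gap-above : ∀ {m} g σ → Stirling (g ++ m ∷ σ) → All (m ≤_) (g ++ m ∷ σ) → UniformExcept m (g ++ m ∷ σ) → m ∉ g →
              WordAbove m g × Stirling σ × All (m ≤_) σ × UniformExcept m σ
  gap-above {m} g σ st m≤ u m∉g =
    (Stirling-++⁻ˡ g (m ∷ σ) st , UniformExcept⇒Uniform (proj₁ uniform) m∉g , ≤∧∉⇒< g (All.++⁻ˡ g m≤) m∉g) ,
    proj₂ (Stirling-++⁻ʳ g (m ∷ σ) st) , All.tail (All.++⁻ʳ g m≤) , proj₂ uniform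
    where uniform = UniformExcept-split g σ (gap-disjoint g σ st m≤ m∉g) u

  gaps-above : ∀ {m} gs R → Stirling (joinWith m gs R) → All (m ≤_) (joinWith m gs R) → UniformExcept m (joinWith m gs R) →
               All (m ∉_) gs → m ∉ R → All (WordAbove m) gs × WordAbove m R
  gaps-above [] R st m≤ u [] m∉R = [] , st , UniformExcept⇒Uniform u m∉R , ≤∧∉⇒< R m≤ m∉R
  gaps-above (g ∷ gs) R st m≤ u (m∉g ∷ m∉gs) m∉R
    with above , st′ , m≤′ , u′ ← gap-above g _ st m≤ u m∉g
    with aboves , aboveR ← gaps-above gs R st′ m≤′ u′ m∉gs m∉R
    = above ∷ aboves , aboveR

  MinimumSplit : ℕ → List ℕ → Set
  MinimumSplit m σ = ∃₂ λ gs R → σ ≡ joinWith m gs R × length gs ≡ K × All (WordAbove m) gs × WordAbove m R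

  split-at-minimum : ∀ {m} σ → count m σ ≡ K → All (m ≤_) σ → Stirling σ → UniformExcept m σ → MinimumSplit m σ
  split-at-minimum {m} σ occurrences m≤ st u
    with gs , R , refl , len , m∉gs , m∉R ← split-at m K σ occurrences
    with aboves , aboveR ← gaps-above gs R st m≤ u m∉gs m∉R
    = gs , R , refl , len , aboves , aboveR

  ForestOf : List ℕ → Set
  ForestOf σ = Σ (List ENode) λ es → PrunedEs es × IncreasingO (onode es) × forestWord es ≡ σ

  NodeOf : ℕ → List (List ℕ) → Set
  NodeOf m gs = Σ (List ONode) λ cs → PrunedE (enode m cs) × IncreasingE (enode m cs) × gaps (enode m cs) ≡ gs

  labelsOs-above : ∀ {m} os → All (All (m <_)) (map childWord os) → All (m <_) (labelsOs os)
  labelsOs-above [] _ = []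
  labelsOs-above (o ∷ os) (above ∷ aboves) =
    All.++⁺ (All.tabulate (All.lookup above ∘ ∈-childWord⁺ o)) (labelsOs-above os aboves)

  leaves-childWords : ∀ os → allLeaves os ≡ true → map childWord os ≡ replicate (length os) []
  leaves-childWords [] _ = refl
  leaves-childWords (onode [] ∷ os) leaves = cong ([] ∷_) (leaves-childWords os leaves)

  node-of-children : ∀ m os → length os ≡ K → PrunedOs os → IncreasingOs os → All (m <_) (labelsOs os) →
                     NodeOf m (map childWord os)
  node-of-children m os len p i m< with allLeaves os in leaves
  ... | true = [] , tt , ([] , tt) , trans (cong (λ n → replicate n []) (sym len)) (sym (leaves-childWords os leaves))
  node-of-children m (o ∷ os) len p i m< | false = o ∷ os , (len , leaves , p) , (m< , i) , refl

  Uniform-count : ∀ {m σ} → Uniform σ → m ∈ σ → count m σ ≡ K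
  Uniform-count {m} u m∈ with u m
  ... | inj₁ none = ⊥-elim (count≡0⇒∉ none m∈)
  ... | inj₂ k = k

  mutual
    decode-forest : ∀ n σ → length σ ≤ n → Stirling σ → Uniform σ → ForestOf σ
    decode-forest n [] _ _ _ = [] , tt , ([] , tt) , refl
    decode-forest (suc n) σ@(x ∷ xs) len st u with m , m∈ , m≤ ← least x xs =
      decode-from-minimum n len (split-at-minimum σ (Uniform-count u m∈) m≤ st (λ v _ → u v))

    decode-from-minimum : ∀ n {m σ} → length σ ≤ suc n → MinimumSplit m σ → ForestOf σ
    decode-from-minimum n {m} len (gs , R , refl , lenGs , aboves , (stR , uR , m<R))
      with cs , p , i , refl ← decode-node n m gs lenGs (All.map (λ g< → ≤-pred (≤-trans g< len)) (length-gaps< m gs R)) aboves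
      with es , ps , (linked , is) , refl ← decode-forest n R (≤-pred (≤-trans (length-rest< m gs R (subst (0 <_) (sym lenGs) (s≤s z≤n))) len)) stR uR
      = enode m cs ∷ es , (p , ps) , (linked-above es m<labels linked , i , is) , nodeWord-gaps (enode m cs) (forestWord es)
      where
      m<labels : All (m <_) (labelsEs es)
      m<labels = All.tabulate (All.lookup m<R ∘ ∈-forestWord⁺ es)

    decode-node : ∀ n m gs → length gs ≡ K → All (λ g → length g ≤ n) gs → All (WordAbove m) gs → NodeOf m gs
    decode-node n m gs len lens aboves with os , eqs , ps , is ← decode-children n gs lens aboves =
      subst (NodeOf m) eqs (node-of-children m os (trans (sym (length-map childWord os)) (trans (cong length eqs) len)) ps is
                              (labelsOs-above os (subst (All (All (m <_))) (sym eqs) (All.map (proj₂ ∘ proj₂) aboves))))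

    decode-children : ∀ {m} n gs → All (λ g → length g ≤ n) gs → All (WordAbove m) gs →
                      Σ (List ONode) λ os → map childWord os ≡ gs × PrunedOs os × IncreasingOs os
    decode-children n [] _ _ = [] , refl , tt , tt
    decode-children n (g ∷ gs) (len ∷ lens) ((st , u , _) ∷ aboves)
      with es , p , i , eq ← decode-forest n g len st u
      with os , eqs , ps , is ← decode-children n gs lens aboves
      = onode es ∷ os , cong₂ _∷_ eq eqs , (p , ps) , (i , is)

  Uniform-∷ʳ : ∀ {x xs} → Uniform (x ∷ xs) → Uniform (xs ++ [ x ])
  Uniform-∷ʳ {x} {xs} u v = subst (λ n → n ≡ 0 ⊎ n ≡ K) (sym (count-∷ʳ v x xs)) (u v)

  decode-tree : ∀ m ρ → All (m ≤_) ρ → Stirling ρ → Uniform (m ∷ ρ) →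
                Σ ENode λ T → PrunedE T × IncreasingE T × treeWord T ≡ m ∷ ρ
  decode-tree m ρ m≤ρ st u
    with gs , R , eq , lenGs , aboves , (_ , _ , m<R) ←
           split-at-minimum (ρ ++ [ m ]) (Uniform-count (Uniform-∷ʳ u) (∈-++⁺ʳ ρ (here refl))) (All.++⁺ m≤ρ (≤-refl ∷ []))
                            (Stirling-∷ʳ ρ m≤ρ st) (λ v _ → Uniform-∷ʳ u v)
    with refl ← joinWith-∷ʳ ρ m gs R eq (λ m∈R → <-irrefl refl (All.lookup m<R m∈R))
    with cs , p , i , gapsEq ← decode-node (length (ρ ++ [ m ])) m gs lenGs
                                 (All.map <⇒≤ (subst (λ w → All (λ g → length g < length w) gs) (sym eq) (length-gaps< m gs [])))
                                 aboves
    = enode m cs , p , i , cong (m ∷_) (∷ʳ-injectiveˡ (body (enode m cs)) ρ word)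
    where
    word : nodeWord (enode m cs) ≡ ρ ++ [ m ]
    word = trans (sym (++-identityʳ _)) (trans (nodeWord-gaps (enode m cs) []) (trans (cong (λ gs → joinWith m gs []) gapsEq) (sym eq)))

  module Bijection {m₀ M′} (sorted : AllPairs _<_ (m₀ ∷ M′)) where

    M : List ℕ
    M = m₀ ∷ M′

    distinct-M : Distinct M
    distinct-M = sorted⇒Distinct sorted

    uniform-word : ∀ π → π ↭ multisetK K M → Uniform π
    uniform-word π perm v with count v M | count-↭ v perm | count-multisetK v K M | distinct-M v
    ... | zero  | eq₁ | eq₂ | _ = inj₁ (trans eq₁ (trans eq₂ (*-zeroʳ K)))
    ... | suc zero | eq₁ | eq₂ | _ = inj₂ (trans eq₁ (trans eq₂ (*-identityʳ K)))
    ... | suc (suc _) | _ | _ | s≤s ()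

    m₀-≤-word : ∀ {π} → π ↭ multisetK K M → All (m₀ ≤_) π
    m₀-≤-word perm = All.tabulate (head-≤ sorted ∘ ∈-multisetK⁻ K M ∘ ∈-resp-↭ perm)

    treeWord∈Q : ∀ T → InT M K T → InQ M K (treeWord T)
    treeWord∈Q T (pruned , labels↭M , inc) =
      counts⇒↭ _ _ counts ,
      Stirling⇒IsStirling _ (stirling-treeWord T inc (λ v → subst (_≤ 1) (sym (count-↭ v labels↭M)) (distinct-M v))) ,
      cong just (≤-antisym (All.lookup (root-≤-labels T inc) (∈-resp-↭ (↭-sym labels↭M) (here refl)))
                           (head-≤ sorted (∈-resp-↭ labels↭M (root∈labels T))))
      where
      counts : ∀ v → count v (treeWord T) ≡ count v (multisetK K M)
      counts v = trans (count-treeWord v T (IsPrunedEvenKary⇒PrunedE T pruned))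
                       (trans (cong (K *_) (count-↭ v labels↭M)) (sym (count-multisetK v K M)))

    decode : ∀ π → InQ M K π → Σ[ T ∈ ENode ] InT M K T × treeWord T ≡ π
    decode (.m₀ ∷ ρ) (perm , isStirling , refl)
      with T , pruned , inc , word ← decode-tree m₀ ρ (All.tail (m₀-≤-word perm)) (proj₂ (IsStirling⇒Stirling _ isStirling))
                                                 (uniform-word _ perm)
      = T , (PrunedE⇒IsPrunedEvenKary T pruned , counts⇒↭ _ _ counts , inc) , word
      where
      counts : ∀ v → count v (labelsE T) ≡ count v M
      counts v = *-cancelˡ-≡ _ _ K (begin
        K * count v (labelsE T)   ≡⟨ count-treeWord v T pruned ⟨
        count v (treeWord T)      ≡⟨ cong (count v) word ⟩
        count v (m₀ ∷ ρ)          ≡⟨ count-↭ v perm ⟩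
        count v (multisetK K M)   ≡⟨ count-multisetK v K M ⟩
        K * count v M             ∎)
        where open ≡-Reasoning

    treeWord-injectiveᵀ : ∀ {T T′} → InT M K T → InT M K T′ → treeWord T ≡ treeWord T′ → T ≡ T′
    treeWord-injectiveᵀ {T} {T′} (pruned , _ , inc) (pruned′ , _ , inc′) =
      treeWord-injective T T′ (IsPrunedEvenKary⇒PrunedE T pruned) (IsPrunedEvenKary⇒PrunedE T′ pruned′) inc inc′

    ap-treeWordᵀ : 2 ≤ length M → ∀ T → InT M K T → ap K (treeWord T) ≡ lleafE T
    ap-treeWordᵀ two (enode c []) (_ , labels↭M , _) with s≤s () ← subst (2 ≤_) (sym (↭-length labels↭M)) two
    ap-treeWordᵀ _ T@(enode c (o ∷ os)) (pruned , _ , inc) = ap-treeWord c o os (IsPrunedEvenKary⇒PrunedE T pruned) inc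

    firstK-treeWordᵀ : 2 ≤ length M → ∀ T → InT M K T → FirstKEqual K (treeWord T) ⇔ FirstRootChildrenLeaves K T
    firstK-treeWordᵀ two (enode c []) (_ , labels↭M , _) with s≤s () ← subst (2 ≤_) (sym (↭-length labels↭M)) two
    firstK-treeWordᵀ _ (enode c (o ∷ os)) (_ , _ , c< , _) = firstK-treeWord c o os c<

proposition3p2 : (k : ℕ) → 1 ≤ k → (M : List ℕ) → AllPairs _<_ M → All (0 <_) M → 2 ≤ length M →
    Σ[ χ ∈ ((π : List ℕ) → InQ M k π → ENode) ]
      ((∀ π (p : InQ M k π) → InT M k (χ π p))
      × (∀ π π' (p : InQ M k π) (p' : InQ M k π') → π ≡ π' → χ π p ≡ χ π' p')
      × (∀ π π' (p : InQ M k π) (p' : InQ M k π') → χ π p ≡ χ π' p' → π ≡ π')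
      × (∀ T → InT M k T → Σ[ π ∈ List ℕ ] Σ[ p ∈ InQ M k π ] χ π p ≡ T)
      × (∀ π (p : InQ M k π) → ap k π ≡ lleafE (χ π p))
      × (∀ π (p : InQ M k π) → FirstKEqual k π ⇔ FirstRootChildrenLeaves k (χ π p)))
proposition3p2 (suc k′) (s≤s z≤n) (m₀ ∷ M′) sorted _ two =
  χ , χ∈T , respects-≡ , injective , surjective , ap≡lleaf , first-k
  where
  open Correspondence k′
  open Bijection sorted
  χ : (π : List ℕ) → InQ M K π → ENode
  χ π p = proj₁ (decode π p)
  χ∈T : ∀ π (p : InQ M K π) → InT M K (χ π p)
  χ∈T π p = proj₁ (proj₂ (decode π p))
  word : ∀ π (p : InQ M K π) → treeWord (χ π p) ≡ π
  word π p = proj₂ (proj₂ (decode π p))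
  respects-≡ : ∀ π π′ (p : InQ M K π) (p′ : InQ M K π′) → π ≡ π′ → χ π p ≡ χ π′ p′
  respects-≡ π .π p p′ refl = treeWord-injectiveᵀ (χ∈T π p) (χ∈T π p′) (trans (word π p) (sym (word π p′)))
  injective : ∀ π π′ (p : InQ M K π) (p′ : InQ M K π′) → χ π p ≡ χ π′ p′ → π ≡ π′
  injective π π′ p p′ eq = trans (sym (word π p)) (trans (cong treeWord eq) (word π′ p′))
  surjective : ∀ T → InT M K T → Σ[ π ∈ List ℕ ] Σ[ p ∈ InQ M K π ] χ π p ≡ T
  surjective T t = treeWord T , q , treeWord-injectiveᵀ (χ∈T _ q) t (word _ q)
    where q = treeWord∈Q T t
  ap≡lleaf : ∀ π (p : InQ M K π) → ap K π ≡ lleafE (χ π p)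
  ap≡lleaf π p = subst (λ w → ap K w ≡ lleafE (χ π p)) (word π p) (ap-treeWordᵀ two (χ π p) (χ∈T π p))
  first-k : ∀ π (p : InQ M K π) → FirstKEqual K π ⇔ FirstRootChildrenLeaves K (χ π p)
  first-k π p = subst (λ w → FirstKEqual K w ⇔ FirstRootChildrenLeaves K (χ π p)) (word π p) (firstK-treeWordᵀ two (χ π p) (χ∈T π p))
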